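{- For all integers $m, s \geq 0$, $$S(m, m+s) = \sum_{k\in\mathbb{Z}} (-1)^k \binom{2m}{m-k}\binom{2s}{s+2k},$$ where $S(m,n) = \dfrac{(2m)!\,(2n)!}{m!\,n!\,(m+n)!}$.
   Context: $S(m,n)$ denotes the super Catalan number $\frac{(2m)!(2n)!}{m!\,n!\,(m+n)!}$ for nonnegative integers $m,n$. Binomial coefficients $\binom{a}{b}$ are taken to be $0$ when $b<0$ or $b>a$, so the sum over $k$ is finite. -}

module Defs where

open import Data.Nat as ℕ using (ℕ; zero; suc; _!)
open import Data.Nat.Properties using (m*n≢0; _!≢0)
open import Data.Nat.Combinatorics using (_C_)
open import Data.Integer as ℤ using (ℤ; +_; -[1+_]; _-_; -_)
open import Data.Rational as ℚ using (ℚ; _/_)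

-- Binomial coefficient with integer lower index: 0 when the lower index is
-- negative (and ℕ's _C_ already returns 0 when it exceeds the upper index).
binomℤ : ℕ → ℤ → ℤ
binomℤ a (+ b)    = + (a C b)
binomℤ a -[1+ _ ] = + 0

sign : ℤ → ℤ
sign k = (- (+ 1)) ℤ.^ ℤ.∣ k ∣

sumFrom : ℤ → ℕ → (ℤ → ℤ) → ℤ
sumFrom lo zero    f = + 0
sumFrom lo (suc n) f = f lo ℤ.+ sumFrom (lo ℤ.+ + 1) n f

sumSym : ℕ → (ℤ → ℤ) → ℤ
sumSym N f = sumFrom (- (+ N)) (suc (2 ℕ.* N)) f

superCatalan : ℕ → ℕ → ℚ
superCatalan m n =
  _/_ (+ ((2 ℕ.* m) ! ℕ.* (2 ℕ.* n) !)) (m ! ℕ.* n ! ℕ.* (m ℕ.+ n) !)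
    {{m*n≢0 (m ! ℕ.* n !) ((m ℕ.+ n) !)
       {{m*n≢0 (m !) (n !) {{m !≢0}} {{n !≢0}}}} {{(m ℕ.+ n) !≢0}}}}

-- Write T(m, w) = Σ_k (-1)^k C(2m, m-k) w(2k), so that the theorem's sum is T(m, C(2s, s + ·)).
-- Pascal's rule applied twice gives C(2m+2, m+1+j) = C(2m, m+j-1) + 2 C(2m, m+j) + C(2m, m+j+1);
-- shifting k by ±1 in the outer terms flips the sign (-1)^k, whence
--   T(m+1, w) = 2 T(m, w) - T(m, w(· - 2)) - T(m, w(· + 2)).
-- For w = C(2s, s + ·) the same Pascal identity in s rewrites the right-hand side as
-- 4 T(m, C(2s+2, s+1+·)) - T(m, C(2s+4, s+2+·)). The super Catalan numbers satisfy the same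
-- recurrence S(m+1, n+1) = 4 S(m, n+1) - S(m, n+2) and agree at m = 0 with C(2s, s), so
-- induction on m (for all s at once) proves the identity.
module Submission where

open import Defs
open import Data.Nat as ℕ using (ℕ; zero; suc; _!)
import Data.Nat.Properties as ℕ
open import Data.Nat.Combinatorics
  using (_C_; nCk+nC[k+1]≡[n+1]C[k+1]; k>n⇒nCk≡0; nCk≡n!/k![n-k]!; k![n∸k]!∣n!)
open import Data.Nat.DivMod using (m/n*n≡m)
open import Data.Integer as ℤ using (ℤ; +_; +[1+_]; -[1+_]; _-_; -_; _+_; _*_)
open import Data.Integer.Properties
open import Data.Integer.Tactic.RingSolver using (solve-∀; solve)
open import Data.List.Base using (_∷_; [])
open import Data.Rational as ℚ using ()
open import Data.Rational.Properties using (fromℚᵘ-cong)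
open import Data.Rational.Unnormalised using (mkℚᵘ; *≡*)
open import Relation.Binary.PropositionalEquality

-- Finite sums

sumFrom-cong : ∀ lo n {f g : ℤ → ℤ} → (∀ k → f k ≡ g k) → sumFrom lo n f ≡ sumFrom lo n g
sumFrom-cong lo zero    f≗g = refl
sumFrom-cong lo (suc n) f≗g = cong₂ _+_ (f≗g lo) (sumFrom-cong (lo + + 1) n f≗g)

sumFrom-- : ∀ lo n (f g : ℤ → ℤ) →
            sumFrom lo n (λ k → f k - g k) ≡ sumFrom lo n f - sumFrom lo n g
sumFrom-- lo zero    f g = refl
sumFrom-- lo (suc n) f g = begin
  f lo - g lo + sumFrom (lo + + 1) n (λ k → f k - g k)
    ≡⟨ cong (_+_ (f lo - g lo)) (sumFrom-- (lo + + 1) n f g) ⟩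
  f lo - g lo + (sumFrom (lo + + 1) n f - sumFrom (lo + + 1) n g)
    ≡⟨ interchange (f lo) (g lo) _ _ ⟩
  f lo + sumFrom (lo + + 1) n f - (g lo + sumFrom (lo + + 1) n g) ∎
  where
  open ≡-Reasoning
  interchange : ∀ a b c d → a - b + (c - d) ≡ a + c - (b + d)
  interchange = solve-∀

sumFrom-*ˡ : ∀ lo n c (f : ℤ → ℤ) → sumFrom lo n (λ k → c * f k) ≡ c * sumFrom lo n f
sumFrom-*ˡ lo zero    c f = sym (*-zeroʳ c)
sumFrom-*ˡ lo (suc n) c f =
  trans (cong (_+_ (c * f lo)) (sumFrom-*ˡ (lo + + 1) n c f)) (sym (*-distribˡ-+ c (f lo) _))

sumFrom-shift : ∀ lo n c (f : ℤ → ℤ) → sumFrom lo n (λ k → f (k + c)) ≡ sumFrom (lo + c) n f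
sumFrom-shift lo zero    c f = refl
sumFrom-shift lo (suc n) c f = cong (_+_ (f (lo + c))) (begin
  sumFrom (lo + + 1) n (λ k → f (k + c)) ≡⟨ sumFrom-shift (lo + + 1) n c f ⟩
  sumFrom (lo + + 1 + c) n f            ≡⟨ cong (λ i → sumFrom i n f) (swap lo c) ⟩
  sumFrom (lo + c + + 1) n f            ∎)
  where
  open ≡-Reasoning
  swap : ∀ a c → a + + 1 + c ≡ a + c + + 1
  swap = solve-∀

sumFrom-++ : ∀ lo a b (f : ℤ → ℤ) →
             sumFrom lo (a ℕ.+ b) f ≡ sumFrom lo a f + sumFrom (lo + + a) b f
sumFrom-++ lo zero    b f = sym (trans (+-identityˡ _) (cong (λ i → sumFrom i b f) (+-identityʳ lo)))
sumFrom-++ lo (suc a) b f = begin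
  f lo + sumFrom (lo + + 1) (a ℕ.+ b) f
    ≡⟨ cong (_+_ (f lo)) (sumFrom-++ (lo + + 1) a b f) ⟩
  f lo + (sumFrom (lo + + 1) a f + sumFrom (lo + + 1 + + a) b f)
    ≡⟨ sym (+-assoc (f lo) _ _) ⟩
  f lo + sumFrom (lo + + 1) a f + sumFrom (lo + + 1 + + a) b f
    ≡⟨ cong (λ i → f lo + sumFrom (lo + + 1) a f + sumFrom i b f) (+-assoc lo (+ 1) (+ a)) ⟩
  f lo + sumFrom (lo + + 1) a f + sumFrom (lo + + suc a) b f ∎
  where open ≡-Reasoning

record VanishesBeyond (m : ℕ) (f : ℤ → ℤ) : Set where
  field
    vanishes-above : ∀ d → f +[1+ d ℕ.+ m ] ≡ + 0
    vanishes-below : ∀ d → f -[1+ d ℕ.+ m ] ≡ + 0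

open VanishesBeyond

module _ {m} {f : ℤ → ℤ} (f-vanishes : VanishesBeyond m f) where

  sumFrom-vanishing-left : ∀ a → sumFrom (- + (a ℕ.+ m)) a f ≡ + 0
  sumFrom-vanishing-left zero    = refl
  sumFrom-vanishing-left (suc a) =
    cong₂ _+_ (vanishes-below f-vanishes a)
              (trans (cong (λ i → sumFrom i a f) (step (+ (a ℕ.+ m))))
                     (sumFrom-vanishing-left a))
    where
    step : ∀ x → - (+ 1 + x) + + 1 ≡ - x
    step = solve-∀

  sumFrom-vanishing-right : ∀ d b → sumFrom +[1+ d ℕ.+ m ] b f ≡ + 0
  sumFrom-vanishing-right d zero    = refl
  sumFrom-vanishing-right d (suc b) =
    cong₂ _+_ (vanishes-above f-vanishes d)
              (trans (cong (λ i → sumFrom (+ i) b f) (ℕ.+-comm (suc (d ℕ.+ m)) 1))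
                     (sumFrom-vanishing-right (suc d) b))

  sumFrom-padded : ∀ a b →
                   sumFrom (- + (a ℕ.+ m)) (a ℕ.+ (suc (2 ℕ.* m) ℕ.+ b)) f ≡ sumSym m f
  sumFrom-padded a b = begin
    sumFrom (- + (a ℕ.+ m)) (a ℕ.+ (suc (2 ℕ.* m) ℕ.+ b)) f
      ≡⟨ sumFrom-++ _ a _ f ⟩
    sumFrom (- + (a ℕ.+ m)) a f + sumFrom (- + (a ℕ.+ m) + + a) (suc (2 ℕ.* m) ℕ.+ b) f
      ≡⟨ cong₂ _+_ (sumFrom-vanishing-left a)
                   (cong (λ i → sumFrom i (suc (2 ℕ.* m) ℕ.+ b) f) (unpad (+ a) (+ m) (pos-+ a m))) ⟩
    + 0 + sumFrom (- + m) (suc (2 ℕ.* m) ℕ.+ b) f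
      ≡⟨ +-identityˡ _ ⟩
    sumFrom (- + m) (suc (2 ℕ.* m) ℕ.+ b) f
      ≡⟨ sumFrom-++ _ (suc (2 ℕ.* m)) b f ⟩
    sumSym m f + sumFrom (- + m + + suc (2 ℕ.* m)) b f
      ≡⟨ cong (λ i → sumSym m f + sumFrom i b f) (right-end (+ m) (pos-* 2 m)) ⟩
    sumSym m f + sumFrom +[1+ m ] b f
      ≡⟨ cong (_+_ (sumSym m f)) (sumFrom-vanishing-right 0 b) ⟩
    sumSym m f + + 0
      ≡⟨ +-identityʳ _ ⟩
    sumSym m f ∎
    where
    open ≡-Reasoning
    unpad : ∀ a x {y} → y ≡ a + x → - y + a ≡ - x
    unpad a x refl = solve (a ∷ x ∷ [])
    right-end : ∀ x {y} → y ≡ + 2 * x → - x + (+ 1 + y) ≡ + 1 + x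
    right-end x refl = solve (x ∷ [])

  sumFrom-window : ∀ a b {lo} → a ℕ.+ b ≡ 2 → lo ≡ - + (a ℕ.+ m) →
                   sumFrom lo (suc (2 ℕ.* suc m)) f ≡ sumSym m f
  sumFrom-window a b a+b≡2 refl =
    trans (cong (λ n → sumFrom (- + (a ℕ.+ m)) n f) length) (sumFrom-padded a b)
    where
    open ≡-Reasoning
    length : suc (2 ℕ.* suc m) ≡ a ℕ.+ (suc (2 ℕ.* m) ℕ.+ b)
    length = begin
      suc (2 ℕ.* suc m)               ≡⟨ cong suc (ℕ.*-suc 2 m) ⟩
      2 ℕ.+ suc (2 ℕ.* m)             ≡⟨ cong (ℕ._+ suc (2 ℕ.* m)) (sym a+b≡2) ⟩
      a ℕ.+ b ℕ.+ suc (2 ℕ.* m)       ≡⟨ ℕ.+-assoc a b _ ⟩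
      a ℕ.+ (b ℕ.+ suc (2 ℕ.* m))     ≡⟨ cong (a ℕ.+_) (ℕ.+-comm b _) ⟩
      a ℕ.+ (suc (2 ℕ.* m) ℕ.+ b)     ∎

-- Binomial coefficients

sign-+1 : ∀ k → sign (k + + 1) ≡ - sign k
sign-+1 (+ n)          = trans (cong ((- + 1) ℤ.^_) (ℕ.+-comm n 1)) (-1*i≡-i _)
sign-+1 -[1+ zero ]    = refl
sign-+1 -[1+ suc n ]   = sym (trans (cong -_ (-1*i≡-i _)) (neg-involutive _))

sign--1 : ∀ k → sign (k - + 1) ≡ - sign k
sign--1 k = begin
  sign (k - + 1)            ≡⟨ sym (neg-involutive _) ⟩
  - - sign (k - + 1)        ≡⟨ cong -_ (sym (sign-+1 (k - + 1))) ⟩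
  - sign (k - + 1 + + 1)    ≡⟨ cong (λ i → - sign i) (cancel k) ⟩
  - sign k                  ∎
  where
  open ≡-Reasoning
  cancel : ∀ k → k - + 1 + + 1 ≡ k
  cancel = solve-∀

binomℤ-pascal : ∀ n i → binomℤ (suc n) i ≡ binomℤ n (i - + 1) + binomℤ n i
binomℤ-pascal n (+ zero)  = refl
binomℤ-pascal n +[1+ k ]  = trans (cong +_ (sym (nCk+nC[k+1]≡[n+1]C[k+1] n k))) (pos-+ (n C k) _)
binomℤ-pascal n -[1+ k ]  = refl

smooth : (ℤ → ℤ) → ℤ → ℤ
smooth w j = w (j - + 1) + + 2 * w j + w (j + + 1)

smooth-cong : ∀ {v w : ℤ → ℤ} → (∀ x → v x ≡ w x) → ∀ j → smooth v j ≡ smooth w j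
smooth-cong v≗w j = cong₂ _+_ (cong₂ _+_ (v≗w _) (cong (+ 2 *_) (v≗w j))) (v≗w _)

smooth-twice : ∀ w j →
  + 4 * smooth w j - smooth (smooth w) j ≡ + 2 * w j - w (j - + 2) - w (j + + 2)
smooth-twice w j = begin
  + 4 * smooth w j - (smooth w (j - + 1) + + 2 * smooth w j + smooth w (j + + 1))
    ≡⟨ cong₂ (λ x y → + 4 * smooth w j - (x + + 2 * smooth w j + y)) smooth-pred smooth-suc ⟩
  + 4 * smooth w j - (w (j - + 2) + + 2 * w (j - + 1) + w j
                      + + 2 * smooth w j
                      + (w j + + 2 * w (j + + 1) + w (j + + 2)))
    ≡⟨ collect (w (j - + 2)) (w (j - + 1)) (w j) (w (j + + 1)) (w (j + + 2)) ⟩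
  + 2 * w j - w (j - + 2) - w (j + + 2) ∎
  where
  open ≡-Reasoning
  smooth-pred : smooth w (j - + 1) ≡ w (j - + 2) + + 2 * w (j - + 1) + w j
  smooth-pred = cong₂ (λ x y → w x + + 2 * w (j - + 1) + w y) (solve (j ∷ [])) (solve (j ∷ []))
  smooth-suc : smooth w (j + + 1) ≡ w j + + 2 * w (j + + 1) + w (j + + 2)
  smooth-suc = cong₂ (λ x y → w x + + 2 * w (j + + 1) + w y) (solve (j ∷ [])) (solve (j ∷ []))
  collect : ∀ a b x y z →
    + 4 * (b + + 2 * x + y) - (a + + 2 * b + x + + 2 * (b + + 2 * x + y) + (x + + 2 * y + z))
      ≡ + 2 * x - a - z
  collect = solve-∀

centredBinom : ℕ → ℤ → ℤ
centredBinom n j = binomℤ (2 ℕ.* n) (+ n + j)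

centredBinom-vanishes : ∀ n → VanishesBeyond n (centredBinom n)
centredBinom-vanishes n = record
  { vanishes-above = λ d → cong +_ (k>n⇒nCk≡0 (2n<n+[1+d+n] d))
  ; vanishes-below = λ d → cong (binomℤ (2 ℕ.* n)) (below (+ d) (+ n))
  }
  where
  2n<n+[1+d+n] : ∀ d → 2 ℕ.* n ℕ.< n ℕ.+ suc (d ℕ.+ n)
  2n<n+[1+d+n] d = ℕ.+-monoʳ-< n (ℕ.s≤s (ℕ.≤-trans (ℕ.≤-reflexive (ℕ.+-identityʳ n)) (ℕ.m≤n+m n d)))
  below : ∀ d n → n + - (+ 1 + d + n) ≡ - (+ 1 + d)
  below = solve-∀

centredBinom-suc : ∀ n j → centredBinom (suc n) j ≡ smooth (centredBinom n) j
centredBinom-suc n j = begin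
  binomℤ (2 ℕ.* suc n) i
    ≡⟨ cong (λ N → binomℤ N i) (ℕ.*-suc 2 n) ⟩
  binomℤ (suc (suc (2 ℕ.* n))) i
    ≡⟨ trans (binomℤ-pascal _ i) (cong₂ _+_ (binomℤ-pascal _ (i - + 1)) (binomℤ-pascal _ i)) ⟩
  B (i - + 1 - + 1) + B (i - + 1) + (B (i - + 1) + B i)
    ≡⟨ cong₂ (λ x y → B x + B y + (B y + B i)) (lower (+ n) j) (middle (+ n) j) ⟩
  c (j - + 1) + c j + (c j + B i)
    ≡⟨ cong (λ z → c (j - + 1) + c j + (c j + B z)) (upper (+ n) j) ⟩
  c (j - + 1) + c j + (c j + c (j + + 1))
    ≡⟨ double (c (j - + 1)) (c j) (c (j + + 1)) ⟩
  smooth c j ∎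
  where
  open ≡-Reasoning
  i = + suc n + j
  B = binomℤ (2 ℕ.* n)
  c = centredBinom n
  lower : ∀ n j → + 1 + n + j - + 1 - + 1 ≡ n + (j - + 1)
  lower = solve-∀
  middle : ∀ n j → + 1 + n + j - + 1 ≡ n + j
  middle = solve-∀
  upper : ∀ n j → + 1 + n + j ≡ n + (j + + 1)
  upper = solve-∀
  double : ∀ x y z → x + y + (y + z) ≡ x + + 2 * y + z
  double = solve-∀

centredBinom-4-step : ∀ s j →
  + 4 * centredBinom (suc s) j - centredBinom (suc (suc s)) j
    ≡ + 2 * centredBinom s j - centredBinom s (j - + 2) - centredBinom s (j + + 2)
centredBinom-4-step s j = begin
  + 4 * centredBinom (suc s) j - centredBinom (suc (suc s)) j
    ≡⟨ cong₂ (λ x y → + 4 * x - y) (centredBinom-suc s j)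
             (trans (centredBinom-suc (suc s) j) (smooth-cong (centredBinom-suc s) j)) ⟩
  + 4 * smooth (centredBinom s) j - smooth (smooth (centredBinom s)) j
    ≡⟨ smooth-twice (centredBinom s) j ⟩
  + 2 * centredBinom s j - centredBinom s (j - + 2) - centredBinom s (j + + 2) ∎
  where open ≡-Reasoning

-- Alternating sums

-- alternatingSum m (centredBinom s) is, by definition, the sum in the theorem.
alternatingTerm : ℕ → (ℤ → ℤ) → ℤ → ℤ
alternatingTerm m w k = sign k * centredBinom m (- k) * w (+ 2 * k)

alternatingSum : ℕ → (ℤ → ℤ) → ℤ
alternatingSum m w = sumSym m (alternatingTerm m w)

alternatingTerm-vanishes : ∀ m w → VanishesBeyond m (alternatingTerm m w)
alternatingTerm-vanishes m w = record
  { vanishes-above = λ d → middle-zero +[1+ d ℕ.+ m ] (vanishes-below (centredBinom-vanishes m) d)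
  ; vanishes-below = λ d → middle-zero -[1+ d ℕ.+ m ] (vanishes-above (centredBinom-vanishes m) d)
  }
  where
  middle-zero : ∀ k → centredBinom m (- k) ≡ + 0 → alternatingTerm m w k ≡ + 0
  middle-zero k c≡0 = begin
    sign k * centredBinom m (- k) * w (+ 2 * k) ≡⟨ cong (λ x → sign k * x * w (+ 2 * k)) c≡0 ⟩
    sign k * + 0 * w (+ 2 * k)                  ≡⟨ cong (_* w (+ 2 * k)) (*-zeroʳ (sign k)) ⟩
    + 0 * w (+ 2 * k)                           ≡⟨ *-zeroˡ (w (+ 2 * k)) ⟩
    + 0                                         ∎
    where open ≡-Reasoning

alternatingTerm-suc : ∀ m w k → alternatingTerm (suc m) w k ≡
  + 2 * alternatingTerm m w k
    - alternatingTerm m (λ j → w (j - + 2)) (k + + 1)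
    - alternatingTerm m (λ j → w (j + + 2)) (k - + 1)
alternatingTerm-suc m w k = begin
  sign k * centredBinom (suc m) (- k) * W
    ≡⟨ cong (λ x → sign k * x * W) (centredBinom-suc m (- k)) ⟩
  sign k * smooth c (- k) * W
    ≡⟨ distribute (sign k) (c (- k - + 1)) (c (- k)) (c (- k + + 1)) W ⟩
  + 2 * alternatingTerm m w k - - sign k * c (- k - + 1) * W - - sign k * c (- k + + 1) * W
    ≡⟨ cong₂ (λ x y → + 2 * alternatingTerm m w k - x - y) (sym term-right) (sym term-left) ⟩
  + 2 * alternatingTerm m w k
    - alternatingTerm m (λ j → w (j - + 2)) (k + + 1)
    - alternatingTerm m (λ j → w (j + + 2)) (k - + 1) ∎
  where
  open ≡-Reasoning
  c = centredBinom m
  W = w (+ 2 * k)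
  distribute : ∀ σ x y z W →
    σ * (x + + 2 * y + z) * W ≡ + 2 * (σ * y * W) - - σ * x * W - - σ * z * W
  distribute = solve-∀
  neg-+ : ∀ k a → - (k + a) ≡ - k - a
  neg-+ = solve-∀
  double-shift : ∀ k a → + 2 * (k + a) - + 2 * a ≡ + 2 * k
  double-shift = solve-∀
  term-right : alternatingTerm m (λ j → w (j - + 2)) (k + + 1) ≡ - sign k * c (- k - + 1) * W
  term-right = cong₂ _*_ (cong₂ (λ σ i → σ * c i) (sign-+1 k) (neg-+ k (+ 1)))
                         (cong w (double-shift k (+ 1)))
  term-left : alternatingTerm m (λ j → w (j + + 2)) (k - + 1) ≡ - sign k * c (- k + + 1) * W
  term-left = cong₂ _*_ (cong₂ (λ σ i → σ * c i) (sign--1 k) (neg-+ k (- + 1)))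
                        (cong w (double-shift k (- + 1)))

alternatingSum-suc : ∀ m w → alternatingSum (suc m) w ≡
  + 2 * alternatingSum m w
    - alternatingSum m (λ j → w (j - + 2))
    - alternatingSum m (λ j → w (j + + 2))
alternatingSum-suc m w = begin
  sumFrom lo L (alternatingTerm (suc m) w)
    ≡⟨ sumFrom-cong lo L (alternatingTerm-suc m w) ⟩
  sumFrom lo L (λ k → + 2 * t k - t₋ (k + + 1) - t₊ (k - + 1))
    ≡⟨ linearity ⟩
  + 2 * sumFrom lo L t - sumFrom lo L (λ k → t₋ (k + + 1)) - sumFrom lo L (λ k → t₊ (k - + 1))
    ≡⟨ cong₂ _-_ (cong₂ (λ x y → + 2 * x - y)
                        (sumFrom-window (alternatingTerm-vanishes m w) 1 1 refl refl)
                        (shifted-window w₋ 0 2 (+ 1) refl (lo+1 (+ m))))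
                 (shifted-window w₊ 2 0 (- + 1) refl (lo-1 (+ m))) ⟩
  + 2 * alternatingSum m w - alternatingSum m w₋ - alternatingSum m w₊ ∎
  where
  open ≡-Reasoning
  lo = - + suc m
  L  = suc (2 ℕ.* suc m)
  t  = alternatingTerm m w
  w₋ = λ j → w (j - + 2)
  w₊ = λ j → w (j + + 2)
  t₋ = alternatingTerm m w₋
  t₊ = alternatingTerm m w₊
  linearity : sumFrom lo L (λ k → + 2 * t k - t₋ (k + + 1) - t₊ (k - + 1))
              ≡ + 2 * sumFrom lo L t - sumFrom lo L (λ k → t₋ (k + + 1)) - sumFrom lo L (λ k → t₊ (k - + 1))
  linearity =
    trans (sumFrom-- lo L (λ k → + 2 * t k - t₋ (k + + 1)) (λ k → t₊ (k - + 1)))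
          (cong (_- sumFrom lo L (λ k → t₊ (k - + 1)))
                (trans (sumFrom-- lo L (λ k → + 2 * t k) (λ k → t₋ (k + + 1)))
                       (cong (_- sumFrom lo L (λ k → t₋ (k + + 1))) (sumFrom-*ˡ lo L (+ 2) t))))
  lo+1 : ∀ x → - (+ 1 + x) + + 1 ≡ - x
  lo+1 = solve-∀
  lo-1 : ∀ x → - (+ 1 + x) - + 1 ≡ - (+ 1 + (+ 1 + x))
  lo-1 = solve-∀
  shifted-window : ∀ v a b c → a ℕ.+ b ≡ 2 → lo + c ≡ - + (a ℕ.+ m) →
                   sumFrom lo L (λ k → alternatingTerm m v (k + c)) ≡ alternatingSum m v
  shifted-window v a b c a+b≡2 lo+c≡ =
    trans (sumFrom-shift lo L c (alternatingTerm m v))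
          (sumFrom-window (alternatingTerm-vanishes m v) a b a+b≡2 lo+c≡)

alternatingSum-cong : ∀ m {v w : ℤ → ℤ} → (∀ j → v j ≡ w j) → alternatingSum m v ≡ alternatingSum m w
alternatingSum-cong m v≗w =
  sumFrom-cong (- + m) (suc (2 ℕ.* m)) (λ k → cong (λ x → sign k * centredBinom m (- k) * x) (v≗w (+ 2 * k)))

alternatingSum-- : ∀ m (v w : ℤ → ℤ) →
                   alternatingSum m (λ j → v j - w j) ≡ alternatingSum m v - alternatingSum m w
alternatingSum-- m v w = trans
  (sumFrom-cong (- + m) (suc (2 ℕ.* m)) (λ k → distribute (sign k * centredBinom m (- k)) (v (+ 2 * k)) (w (+ 2 * k))))
  (sumFrom-- (- + m) (suc (2 ℕ.* m)) (alternatingTerm m v) (alternatingTerm m w))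
  where
  distribute : ∀ x a b → x * (a - b) ≡ x * a - x * b
  distribute = solve-∀

alternatingSum-*ˡ : ∀ m a (w : ℤ → ℤ) → alternatingSum m (λ j → a * w j) ≡ a * alternatingSum m w
alternatingSum-*ˡ m a w = trans
  (sumFrom-cong (- + m) (suc (2 ℕ.* m)) (λ k → rearrange (sign k * centredBinom m (- k)) a (w (+ 2 * k))))
  (sumFrom-*ˡ (- + m) (suc (2 ℕ.* m)) a (alternatingTerm m w))
  where
  rearrange : ∀ x a y → x * (a * y) ≡ a * (x * y)
  rearrange = solve-∀

alternatingSum-centredBinom-suc : ∀ m s →
  alternatingSum (suc m) (centredBinom s)
    ≡ + 4 * alternatingSum m (centredBinom (suc s)) - alternatingSum m (centredBinom (suc (suc s)))
alternatingSum-centredBinom-suc m s = begin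
  alternatingSum (suc m) c
    ≡⟨ alternatingSum-suc m c ⟩
  + 2 * A c - A c₋ - A c₊
    ≡⟨ cong (λ x → x - A c₋ - A c₊) (sym (alternatingSum-*ˡ m (+ 2) c)) ⟩
  A (λ j → + 2 * c j) - A c₋ - A c₊
    ≡⟨ cong (_- A c₊) (sym (alternatingSum-- m (λ j → + 2 * c j) c₋)) ⟩
  A (λ j → + 2 * c j - c₋ j) - A c₊
    ≡⟨ sym (alternatingSum-- m (λ j → + 2 * c j - c₋ j) c₊) ⟩
  A (λ j → + 2 * c j - c₋ j - c₊ j)
    ≡⟨ sym (alternatingSum-cong m (centredBinom-4-step s)) ⟩
  A (λ j → + 4 * c′ j - c″ j)
    ≡⟨ alternatingSum-- m (λ j → + 4 * c′ j) c″ ⟩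
  A (λ j → + 4 * c′ j) - A c″
    ≡⟨ cong (_- A c″) (alternatingSum-*ˡ m (+ 4) c′) ⟩
  + 4 * A c′ - A c″ ∎
  where
  open ≡-Reasoning
  A  = alternatingSum m
  c  = centredBinom s
  c′ = centredBinom (suc s)
  c″ = centredBinom (suc (suc s))
  c₋ = λ j → c (j - + 2)
  c₊ = λ j → c (j + + 2)

-- Super Catalan numbers

fact : ℕ → ℤ
fact n = + (n !)

fact-suc : ∀ n → fact (suc n) ≡ + suc n * fact n
fact-suc n = pos-* (suc n) (n !)

fact-2*suc : ∀ n → fact (2 ℕ.* suc n) ≡ (+ 2 + + 2 * + n) * ((+ 1 + + 2 * + n) * fact (2 ℕ.* n))
fact-2*suc n = begin
  fact (2 ℕ.* suc n)
    ≡⟨ cong fact (ℕ.*-suc 2 n) ⟩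
  fact (suc (suc (2 ℕ.* n)))
    ≡⟨ trans (fact-suc (suc (2 ℕ.* n))) (cong (+ suc (suc (2 ℕ.* n)) *_) (fact-suc (2 ℕ.* n))) ⟩
  + suc (suc (2 ℕ.* n)) * (+ suc (2 ℕ.* n) * fact (2 ℕ.* n))
    ≡⟨ cong (λ x → (+ 2 + x) * ((+ 1 + x) * fact (2 ℕ.* n))) (pos-* 2 n) ⟩
  (+ 2 + + 2 * + n) * ((+ 1 + + 2 * + n) * fact (2 ℕ.* n)) ∎
  where open ≡-Reasoning

fact-+-suc : ∀ m n → fact (suc (m ℕ.+ n)) ≡ (+ 1 + (+ m + + n)) * fact (m ℕ.+ n)
fact-+-suc m n = trans (fact-suc (m ℕ.+ n)) (cong (λ x → (+ 1 + x) * fact (m ℕ.+ n)) (pos-+ m n))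

IsSuperCatalan : ℕ → ℕ → ℤ → Set
IsSuperCatalan m n t = t * (fact m * fact n * fact (m ℕ.+ n)) ≡ fact (2 ℕ.* m) * fact (2 ℕ.* n)

-- After multiplying by n + 2 both hypotheses apply, because
-- D(m+1, n+1) = (m+1)(m+n+2) D(m, n+1) and (n+2) D(m+1, n+1) = (m+1) D(m, n+2)
-- for D(m, n) = m! n! (m+n)!.
IsSuperCatalan-suc : ∀ m n t₁ t₂ → IsSuperCatalan m (suc n) t₁ → IsSuperCatalan m (suc (suc n)) t₂ →
                     IsSuperCatalan (suc m) (suc n) (+ 4 * t₁ - t₂)
IsSuperCatalan-suc m n t₁ t₂ S₁ S₂ = *-cancelˡ-≡ (+ 2 + N) _ _ (begin
  (+ 2 + N) * ((+ 4 * t₁ - t₂) * (fact (suc m) * g * fact (suc (m ℕ.+ suc n))))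
    ≡⟨ cong₂ (λ x y → (+ 2 + N) * ((+ 4 * t₁ - t₂) * (x * g * y))) (fact-suc m) (fact-+-suc m (suc n)) ⟩
  (+ 2 + N) * ((+ 4 * t₁ - t₂) * ((+ 1 + M) * f * g * (K * h)))
    ≡⟨ expand t₁ t₂ M N K f g h ⟩
  + 4 * (+ 2 + N) * (+ 1 + M) * K * (t₁ * (f * g * h))
    - (+ 1 + M) * (t₂ * (f * ((+ 2 + N) * g) * (K * h)))
    ≡⟨ cong₂ (λ x y → + 4 * (+ 2 + N) * (+ 1 + M) * K * x - (+ 1 + M) * y) S₁ S₂′ ⟩
  + 4 * (+ 2 + N) * (+ 1 + M) * K * (A * B)
    - (+ 1 + M) * (A * ((+ 2 + + 2 * (+ 1 + N)) * ((+ 1 + + 2 * (+ 1 + N)) * B)))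
    ≡⟨ combine M N A B ⟩
  (+ 2 + N) * ((+ 2 + + 2 * M) * ((+ 1 + + 2 * M) * A) * B)
    ≡⟨ cong (λ x → (+ 2 + N) * (x * B)) (sym (fact-2*suc m)) ⟩
  (+ 2 + N) * (fact (2 ℕ.* suc m) * B) ∎)
  where
  open ≡-Reasoning
  M = + m
  N = + n
  K = + 1 + (M + (+ 1 + N))
  f = fact m
  g = fact (suc n)
  h = fact (m ℕ.+ suc n)
  A = fact (2 ℕ.* m)
  B = fact (2 ℕ.* suc n)
  S₂′ : t₂ * (f * ((+ 2 + N) * g) * (K * h))
          ≡ A * ((+ 2 + + 2 * (+ 1 + N)) * ((+ 1 + + 2 * (+ 1 + N)) * B))
  S₂′ = begin
    t₂ * (f * ((+ 2 + N) * g) * (K * h))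
      ≡⟨ cong₂ (λ x y → t₂ * (f * x * y)) (sym (fact-suc (suc n)))
               (sym (trans (cong fact (ℕ.+-suc m (suc n))) (fact-+-suc m (suc n)))) ⟩
    t₂ * (f * fact (suc (suc n)) * fact (m ℕ.+ suc (suc n)))
      ≡⟨ S₂ ⟩
    A * fact (2 ℕ.* suc (suc n))
      ≡⟨ cong (A *_) (fact-2*suc (suc n)) ⟩
    A * ((+ 2 + + 2 * (+ 1 + N)) * ((+ 1 + + 2 * (+ 1 + N)) * B)) ∎
  expand : ∀ t₁ t₂ M N K f g h →
    (+ 2 + N) * ((+ 4 * t₁ - t₂) * ((+ 1 + M) * f * g * (K * h)))
      ≡ + 4 * (+ 2 + N) * (+ 1 + M) * K * (t₁ * (f * g * h))
        - (+ 1 + M) * (t₂ * (f * ((+ 2 + N) * g) * (K * h)))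
  expand = solve-∀
  combine : ∀ M N A B →
    + 4 * (+ 2 + N) * (+ 1 + M) * (+ 1 + (M + (+ 1 + N))) * (A * B)
      - (+ 1 + M) * (A * ((+ 2 + + 2 * (+ 1 + N)) * ((+ 1 + + 2 * (+ 1 + N)) * B)))
      ≡ (+ 2 + N) * ((+ 2 + + 2 * M) * ((+ 1 + + 2 * M) * A) * B)
  combine = solve-∀

nCk*[k!*[n∸k]!]≡n! : ∀ {n k} → k ℕ.≤ n → (n C k) ℕ.* (k ! ℕ.* (n ℕ.∸ k) !) ≡ n !
nCk*[k!*[n∸k]!]≡n! {n} {k} k≤n = begin
  (n C k) ℕ.* (k ! ℕ.* (n ℕ.∸ k) !)
    ≡⟨ cong (ℕ._* (k ! ℕ.* (n ℕ.∸ k) !)) (nCk≡n!/k![n-k]! k≤n) ⟩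
  (n ! ℕ./ (k ! ℕ.* (n ℕ.∸ k) !)) ℕ.* (k ! ℕ.* (n ℕ.∸ k) !)
    ≡⟨ m/n*n≡m (k![n∸k]!∣n! k≤n) ⟩
  n ! ∎
  where
  open ≡-Reasoning
  instance _ = k ℕ.!* (n ℕ.∸ k) !≢0

IsSuperCatalan-zero : ∀ n → IsSuperCatalan 0 n (centredBinom n (+ 0))
IsSuperCatalan-zero n = begin
  + (2 ℕ.* n C (n ℕ.+ 0)) * (+ 1 * fact n * fact n)
    ≡⟨ cong₂ (λ k x → + (2 ℕ.* n C k) * x) (ℕ.+-identityʳ n) (cong (_* fact n) (*-identityˡ (fact n))) ⟩
  + (2 ℕ.* n C n) * (fact n * fact n)
    ≡⟨ cong (+ (2 ℕ.* n C n) *_) (sym (pos-* (n !) (n !))) ⟩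
  + (2 ℕ.* n C n) * + (n ! ℕ.* n !)
    ≡⟨ sym (pos-* (2 ℕ.* n C n) _) ⟩
  + ((2 ℕ.* n C n) ℕ.* (n ! ℕ.* n !))
    ≡⟨ cong (λ k → + ((2 ℕ.* n C n) ℕ.* (n ! ℕ.* k !))) (sym 2n∸n≡n) ⟩
  + ((2 ℕ.* n C n) ℕ.* (n ! ℕ.* (2 ℕ.* n ℕ.∸ n) !))
    ≡⟨ cong +_ (nCk*[k!*[n∸k]!]≡n! (ℕ.m≤m+n n (n ℕ.+ 0))) ⟩
  fact (2 ℕ.* n)
    ≡⟨ sym (*-identityˡ _) ⟩
  + 1 * fact (2 ℕ.* n) ∎
  where
  open ≡-Reasoning
  2n∸n≡n : 2 ℕ.* n ℕ.∸ n ≡ n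
  2n∸n≡n = trans (ℕ.m+n∸m≡n n (n ℕ.+ 0)) (ℕ.+-identityʳ n)

alternatingSum-zero : ∀ w → alternatingSum 0 w ≡ w (+ 0)
alternatingSum-zero w = trans (+-identityʳ _) (*-identityˡ (w (+ 0)))

alternatingSum-isSuperCatalan : ∀ m s → IsSuperCatalan m (m ℕ.+ s) (alternatingSum m (centredBinom s))
alternatingSum-isSuperCatalan zero    s =
  subst (IsSuperCatalan 0 s) (sym (alternatingSum-zero (centredBinom s))) (IsSuperCatalan-zero s)
alternatingSum-isSuperCatalan (suc m) s =
  subst (IsSuperCatalan (suc m) (suc (m ℕ.+ s))) (sym (alternatingSum-centredBinom-suc m s))
        (IsSuperCatalan-suc m (m ℕ.+ s) t₁ t₂ S₁ S₂)
  where
  t₁ = alternatingSum m (centredBinom (suc s))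
  t₂ = alternatingSum m (centredBinom (suc (suc s)))
  S₁ : IsSuperCatalan m (suc (m ℕ.+ s)) t₁
  S₁ = subst (λ n → IsSuperCatalan m n t₁) (ℕ.+-suc m s) (alternatingSum-isSuperCatalan m (suc s))
  S₂ : IsSuperCatalan m (suc (suc (m ℕ.+ s))) t₂
  S₂ = subst (λ n → IsSuperCatalan m n t₂) (trans (ℕ.+-suc m (suc s)) (cong suc (ℕ.+-suc m s)))
             (alternatingSum-isSuperCatalan m (suc (suc s)))

/-cleared : ∀ p r q .{{_ : ℕ.NonZero q}} → p ≡ r * + q → p ℚ./ q ≡ r ℚ./ 1
/-cleared p r (suc q) p≡r*q = fromℚᵘ-cong {mkℚᵘ p q} {mkℚᵘ r 0} (*≡* (trans (*-identityʳ p) p≡r*q))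

IsSuperCatalan⇒superCatalan : ∀ m n t → IsSuperCatalan m n t → superCatalan m n ≡ t ℚ./ 1
IsSuperCatalan⇒superCatalan m n t S = /-cleared _ t _ {{denominator≢0}} (begin
  + ((2 ℕ.* m) ! ℕ.* (2 ℕ.* n) !)       ≡⟨ pos-* ((2 ℕ.* m) !) _ ⟩
  fact (2 ℕ.* m) * fact (2 ℕ.* n)       ≡⟨ sym S ⟩
  t * (fact m * fact n * fact (m ℕ.+ n)) ≡⟨ cong (t *_) (sym denominator) ⟩
  t * + (m ! ℕ.* n ! ℕ.* (m ℕ.+ n) !)   ∎)
  where
  open ≡-Reasoning
  denominator : + (m ! ℕ.* n ! ℕ.* (m ℕ.+ n) !) ≡ fact m * fact n * fact (m ℕ.+ n)
  denominator = trans (pos-* (m ! ℕ.* n !) _) (cong (_* fact (m ℕ.+ n)) (pos-* (m !) (n !)))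
  denominator≢0 : ℕ.NonZero (m ! ℕ.* n ! ℕ.* (m ℕ.+ n) !)
  denominator≢0 = ℕ.m*n≢0 _ _ {{m ℕ.!* n !≢0}} {{(m ℕ.+ n) ℕ.!≢0}}

proposition2p1 : (m s : ℕ) →
    superCatalan m (m ℕ.+ s)
      ≡ ℚ._/_ (sumSym m (λ k → sign k ℤ.* binomℤ (2 ℕ.* m) (+ m - k)
                                      ℤ.* binomℤ (2 ℕ.* s) (+ s ℤ.+ + 2 ℤ.* k))) 1
proposition2p1 m s =
  IsSuperCatalan⇒superCatalan m (m ℕ.+ s) (alternatingSum m (centredBinom s)) (alternatingSum-isSuperCatalan m s)
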